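{- Let $G$ be a graph and $X,Y$ disjoint subsets of $V(G)$. Let $s'_1,s'_2$ be two non-adjacent vertices that are simplicial in $G[X]$, and for $j=1,2$ let $s_j$ be an $(X,Y)$-minimal simplicial vertex arising from $s'_j$. Then $s_1\neq s_2$ and $s_1s_2\notin E(G)$.
   Context: A vertex $v$ is simplicial in $G[X]$ if $N_X[v]$ (the closed neighborhood of $v$ within $X$) is a clique. For a simplicial vertex $s'$ of $G[X]$, a vertex $s$ is an $(X,Y)$-minimal simplicial vertex arising from $s'$ if $s\in N_X[s']$, $s$ is simplicial in $G[X]$, and $N_Y(s)=N(s)\cap Y$ is minimal under set inclusion among all vertices of $N_X[s']$ that are simplicial in $G[X]$. -}

module Defs where

open import Level using (Level; _⊔_; suc)
open import Data.Product using (_×_)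
open import Data.Sum using (_⊎_)
open import Relation.Binary.PropositionalEquality using (_≡_)
open import Relation.Nullary using (¬_)
open import Data.Empty using (⊥)

record Graph (V : Set) : Set₁ where
  field
    Adj     : V → V → Set
    sym     : ∀ {u v} → Adj u v → Adj v u
    irrefl  : ∀ {v} → ¬ Adj v v

VSet : Set → Set₁
VSet V = V → Set

module _ {V : Set} (G : Graph V) where
  open Graph G

  ClosedNbhIn : VSet V → V → VSet V
  ClosedNbhIn X v u = X u × (u ≡ v ⊎ Adj u v)

  NbhIn : VSet V → V → VSet V
  NbhIn Y v u = Y u × Adj u v

  IsClique : VSet V → Set
  IsClique C = ∀ u w → C u → C w → ¬ (u ≡ w) → Adj u w

  Simplicial : VSet V → V → Set
  Simplicial X v = X v × IsClique (ClosedNbhIn X v)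

  _⊆_ : VSet V → VSet V → Set
  A ⊆ B = ∀ u → A u → B u

  -- s is an (X,Y)-minimal simplicial vertex arising from s'
  -- (s' is assumed simplicial in G[X]; that hypothesis is stated separately).
  MinimalSimplicialFrom : VSet V → VSet V → V → V → Set
  MinimalSimplicialFrom X Y s' s =
    ClosedNbhIn X s' s × Simplicial X s ×
    (∀ t → ClosedNbhIn X s' t → Simplicial X t →
       NbhIn Y t ⊆ NbhIn Y s → NbhIn Y s ⊆ NbhIn Y t)

  Disjoint : VSet V → VSet V → Set
  Disjoint X Y = ∀ v → X v → Y v → ⊥

{-# OPTIONS --safe #-}
module Submission where

-- Neither minimality nor the disjointness of X and Y plays a role: all that
-- matters is that s₁, s₂ are simplicial in G[X] and lie in the closed
-- neighbourhoods of s'₁, s'₂. If s₂ ∈ N_X[s₁], the clique N_X[s₁] pulls s'₁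
-- into N_X[s₂]; but N_X[s₂] is a clique containing s'₂, and s'₁, s'₂ are
-- distinct and non-adjacent.

open import Defs
open import Data.Product using (_×_; _,_)
open import Data.Sum using (inj₁; inj₂; map)
open import Relation.Binary.PropositionalEquality using (_≡_; _≢_; sym)
open import Relation.Nullary using (¬_)

module _ {V : Set} (G : Graph V) {X : VSet V} where
  open Graph G renaming (sym to Adj-sym)

  closedNbhIn-sym : ∀ {u v} → X v → ClosedNbhIn G X v u → ClosedNbhIn G X u v
  closedNbhIn-sym Xv (_ , u≡v⊎uv) = Xv , map sym Adj-sym u≡v⊎uv

  -- Double negation, since equality on V need not be decidable.
  simplicial-closedNbhIn-⊆ : ∀ {s w u} → Simplicial G X s →
    ClosedNbhIn G X s w → ClosedNbhIn G X s u → ¬ ¬ ClosedNbhIn G X w u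
  simplicial-closedNbhIn-⊆ (_ , clique) w∈ u∈@(Xu , _) u∉ =
    u∉ (Xu , inj₂ (clique _ _ u∈ w∈ (λ u≡w → u∉ (Xu , inj₁ u≡w))))

  simplicials-near-nonadjacent-∉ : ∀ {s'₁ s'₂ s₁ s₂} → s'₁ ≢ s'₂ → ¬ Adj s'₁ s'₂ →
    X s'₁ → X s'₂ → Simplicial G X s₁ → Simplicial G X s₂ →
    ClosedNbhIn G X s'₁ s₁ → ClosedNbhIn G X s'₂ s₂ → ¬ ClosedNbhIn G X s₁ s₂
  simplicials-near-nonadjacent-∉ {s'₁} {s'₂} {s₁} {s₂} s'₁≢s'₂ s'₁≁s'₂ Xs'₁ Xs'₂
    simp₁ (_ , clique₂) s₁∈ s₂∈ s₂∈N[s₁] =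
    simplicial-closedNbhIn-⊆ simp₁ s₂∈N[s₁] (closedNbhIn-sym Xs'₁ s₁∈) s'₁∉N[s₂]
    where
    s'₁∉N[s₂] : ¬ ClosedNbhIn G X s₂ s'₁
    s'₁∉N[s₂] s'₁∈ = s'₁≁s'₂ (clique₂ _ _ s'₁∈ (closedNbhIn-sym Xs'₂ s₂∈) s'₁≢s'₂)

lemma2p6 : {V : Set} (G : Graph V) (X Y : VSet V) → Disjoint G X Y →
    (s'₁ s'₂ s₁ s₂ : V) → ¬ (s'₁ ≡ s'₂) → ¬ Graph.Adj G s'₁ s'₂ →
    Simplicial G X s'₁ → Simplicial G X s'₂ →
    MinimalSimplicialFrom G X Y s'₁ s₁ → MinimalSimplicialFrom G X Y s'₂ s₂ →
    ¬ (s₁ ≡ s₂) × ¬ Graph.Adj G s₁ s₂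
lemma2p6 G X Y _ s'₁ s'₂ s₁ s₂ s'₁≢s'₂ s'₁≁s'₂ (Xs'₁ , _) (Xs'₂ , _)
  (s₁∈ , simp₁ , _) (s₂∈ , simp₂@(Xs₂ , _) , _) =
    (λ s₁≡s₂ → s₂∉N[s₁] (Xs₂ , inj₁ (sym s₁≡s₂)))
  , (λ s₁s₂ → s₂∉N[s₁] (Xs₂ , inj₂ (Graph.sym G s₁s₂)))
  where
  s₂∉N[s₁] : ¬ ClosedNbhIn G X s₁ s₂
  s₂∉N[s₁] = simplicials-near-nonadjacent-∉ G s'₁≢s'₂ s'₁≁s'₂ Xs'₁ Xs'₂ simp₁ simp₂ s₁∈ s₂∈
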